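{- For every non-negative integer $d$, with $e=2^d$, every even $n$ with $0\le n\le 2^e-2$, and every suitable tuple $\nu$ of length $e$, the vectors $M_d^\nu w_n$ and $M_d^\nu w_{n+1}$ are complementary (each coordinate of one is $0$ exactly when the corresponding coordinate of the other is $1$).
   Context: Matrices and vectors are over $\mathbb{F}_2$. Define $M_0=(1)$ and $M_{d+1}=\begin{pmatrix}M_d&M_d\\0&M_d\end{pmatrix}$, so $M_d$ is $e\times e$ with $e=2^d$. $w_0,\dots,w_{2^e-1}$ are all vectors of $\mathbb{F}_2^e$ in increasing lexicographic order ($w_n$ is the length-$e$ binary expansion of $n$, first coordinate most significant). Let $\sigma$ act on a column vector by $\sigma(c_1,\dots,c_e)=(c_e,c_1,\dots,c_{e-1})$. A tuple $\nu=(n_1,\dots,n_e)$ of non-negative integers is suitable if $n_e=0$ and $n_{i+1}\le n_i\le n_{i+1}+1$ for $1\le i\le e-1$. With $C_1,\dots,C_e$ the columns of $M_d$, $M_d^\nu=(\sigma^{n_1}(C_1),\dots,\sigma^{n_e}(C_e))$. -}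

module Defs where

open import Data.Bool using (Bool; true; false; _∧_; _xor_; not)
open import Data.Nat using (ℕ; zero; suc; _+_; _*_; _^_; _%_; _/_; _≤_)
open import Data.Nat.Properties using (+-identityʳ)
open import Data.Fin using (Fin; zero; suc; toℕ; fromℕ; inject₁; cast; splitAt)
open import Data.Sum using (inj₁; inj₂)
open import Data.Product using (_×_)
open import Relation.Binary.PropositionalEquality using (_≡_; refl; cong)

-- Vectors over F₂ (F₂ = Bool, addition = xor, multiplication = ∧),
-- indexed 0-based: coordinate c_{i+1} of the paper is  v i.
Vec₂ : ℕ → Set
Vec₂ n = Fin n → Bool

-- Square matrices over F₂:  A r c  is the entry in row r, column c (0-based).
Mat₂ : ℕ → Set
Mat₂ n = Fin n → Fin n → Bool

Σ₂ : ∀ {n} → (Fin n → Bool) → Bool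
Σ₂ {zero}  f = false
Σ₂ {suc n} f = f zero xor Σ₂ (λ i → f (suc i))

_·_ : ∀ {n} → Mat₂ n → Vec₂ n → Vec₂ n
(A · v) r = Σ₂ (λ c → A r c ∧ v c)

2^d+2^d : ∀ d → 2 ^ suc d ≡ 2 ^ d + 2 ^ d
2^d+2^d d = cong (2 ^ d +_) (+-identityʳ (2 ^ d))

-- M₀ = (1),  M_{d+1} = [[M_d, M_d],[0, M_d]]  (size e = 2^d)
M : (d : ℕ) → Mat₂ (2 ^ d)
M zero    r c = true
M (suc d) r c with splitAt (2 ^ d) (cast (2^d+2^d d) r) | splitAt (2 ^ d) (cast (2^d+2^d d) c)
... | inj₁ r' | inj₁ c' = M d r' c'
... | inj₁ r' | inj₂ c' = M d r' c'
... | inj₂ r' | inj₁ c' = false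
... | inj₂ r' | inj₂ c' = M d r' c'

bit : ℕ → ℕ → Bool
bit n zero    = (n % 2) Data.Nat.≡ᵇ 1
bit n (suc b) = bit (n / 2) b

-- w k n : length-k binary expansion of n, first coordinate most significant
-- (coordinate i, 0-based, is bit number k-1-i of n).
w : (k n : ℕ) → Vec₂ k
w (suc k) n zero    = bit n k
w (suc k) n (suc i) = w k n i

predCyc : ∀ {n} → Fin n → Fin n
predCyc {suc m} zero    = fromℕ m
predCyc {suc m} (suc i) = inject₁ i

σ : ∀ {n} → Vec₂ n → Vec₂ n
σ v i = v (predCyc i)

σ^ : ∀ {n} → ℕ → Vec₂ n → Vec₂ n
σ^ zero    v = v
σ^ (suc k) v = σ (σ^ k v)

-- ν = (n₁,…,n_e) given as  ν i = n_{i+1}.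
-- suitable: n_e = 0 and n_{i+1} ≤ n_i ≤ n_{i+1} + 1.
Suitable : (e : ℕ) → (Fin e → ℕ) → Set
Suitable e ν =
  (∀ (i : Fin e) → suc (toℕ i) ≡ e → ν i ≡ 0) ×
  (∀ (i j : Fin e) → toℕ j ≡ suc (toℕ i) → (ν j ≤ ν i) × (ν i ≤ suc (ν j)))

Mν : (d : ℕ) → (Fin (2 ^ d) → ℕ) → Mat₂ (2 ^ d)
Mν d ν r c = σ^ (ν c) (λ r' → M d r' c) r

{-# OPTIONS --safe #-}
module Submission where

-- Since n is even, w_n and w_{n+1} differ only in their last coordinate, so
-- M_d^ν w_n and M_d^ν w_{n+1} differ by the last column of M_d^ν. That column is
-- σ^0 of the last column of M_d (suitability forces n_e = 0), and the last column
-- of M_d is all ones by the block recursion. Adding the all-ones vector over F₂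
-- complements every coordinate.

open import Defs
open import Data.Bool using (true; false; not; _∧_; _xor_)
open import Data.Bool.Properties using (not-distribˡ-xor; not-distribʳ-xor)
open import Data.Nat using (ℕ; zero; suc; _+_; _^_; _%_; _/_; _≤_; _<_; NonZero; ≢-nonZero⁻¹)
open import Data.Nat.Properties using (suc-injective; m+n≡0⇒n≡0; +-identityʳ; m^n≢0; ≤-refl)
open import Data.Nat.DivMod using (%-distribˡ-+; +-distrib-/)
open import Data.Fin using (Fin; zero; suc; toℕ; fromℕ; cast; splitAt)
open import Data.Fin.Properties using (toℕ-injective; toℕ-fromℕ; toℕ-cast)
import Data.Fin.Properties as Fin
open import Data.Sum using (inj₁; inj₂)
open import Data.Product using (Σ; ∃-syntax; _×_; _,_)
open import Function using (_∘_)
open import Relation.Nullary using (¬_; contradiction)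
open import Relation.Binary.PropositionalEquality

IsLast : ∀ {n} → Fin n → Set
IsLast {n} i = suc (toℕ i) ≡ n

IsLast-unique : ∀ {n} {i j : Fin n} → IsLast i → IsLast j → i ≡ j
IsLast-unique last-i last-j = toℕ-injective (suc-injective (trans last-i (sym last-j)))

last-of : ∀ {n} → Fin n → Σ (Fin n) IsLast
last-of {suc m} _ = fromℕ m , cong suc (toℕ-fromℕ m)

cast-IsLast : ∀ {m n} (eq : m ≡ n) {c : Fin m} → IsLast c → IsLast (cast eq c)
cast-IsLast eq {c} last = trans (cong suc (toℕ-cast eq c)) (trans last eq)

splitAt-IsLast : ∀ m {n} .{{_ : NonZero n}} (c : Fin (m + n)) → IsLast c →
                 ∃[ c' ] splitAt m c ≡ inj₂ c' × IsLast c'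
splitAt-IsLast zero          c       last = c , refl , last
splitAt-IsLast (suc m) {n}   zero    last =
  contradiction (m+n≡0⇒n≡0 m (suc-injective (sym last))) (≢-nonZero⁻¹ n)
splitAt-IsLast (suc m)       (suc c) last with splitAt-IsLast m c (suc-injective last)
... | c' , eq , last' rewrite eq = c' , refl , last'

M-lastColumn : ∀ d (r c : Fin (2 ^ d)) → IsLast c → M d r c ≡ true
M-lastColumn zero    r c last = refl
M-lastColumn (suc d) r c last
  with splitAt-IsLast (2 ^ d) {{m^n≢0 2 d}} (cast (2^d+2^d d) c) (cast-IsLast (2^d+2^d d) last)
... | c' , eq , last' with splitAt (2 ^ d) (cast (2^d+2^d d) r)
...   | inj₁ r' rewrite eq = M-lastColumn d r' c' last'
...   | inj₂ r' rewrite eq = M-lastColumn d r' c' last'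

Mν-lastColumn : ∀ d ν (r c : Fin (2 ^ d)) → ν c ≡ 0 → IsLast c → Mν d ν r c ≡ true
Mν-lastColumn d ν r c ν≡0 last rewrite ν≡0 = M-lastColumn d r c last

DiffersOnlyAt : ∀ {n} → Fin n → Vec₂ n → Vec₂ n → Set
DiffersOnlyAt j u v = u j ≡ not (v j) × (∀ i → i ≢ j → u i ≡ v i)

Σ₂-cong : ∀ {n} {f g : Vec₂ n} → (∀ i → f i ≡ g i) → Σ₂ f ≡ Σ₂ g
Σ₂-cong {zero}  f≗g = refl
Σ₂-cong {suc n} f≗g = cong₂ _xor_ (f≗g zero) (Σ₂-cong (f≗g ∘ suc))

Σ₂-differsOnlyAt : ∀ {n} {j} {f g : Vec₂ n} → DiffersOnlyAt j f g → Σ₂ f ≡ not (Σ₂ g)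
Σ₂-differsOnlyAt {j = zero} {f} {g} (at-j , off-j) = begin
  f zero xor Σ₂ (f ∘ suc)       ≡⟨ cong₂ _xor_ at-j (Σ₂-cong λ i → off-j (suc i) λ ()) ⟩
  not (g zero) xor Σ₂ (g ∘ suc) ≡⟨ sym (not-distribˡ-xor (g zero) _) ⟩
  not (Σ₂ g)                    ∎
  where open ≡-Reasoning
Σ₂-differsOnlyAt {j = suc j} {f} {g} (at-j , off-j) = begin
  f zero xor Σ₂ (f ∘ suc)       ≡⟨ cong₂ _xor_ (off-j zero λ ()) (Σ₂-differsOnlyAt tails) ⟩
  g zero xor not (Σ₂ (g ∘ suc)) ≡⟨ sym (not-distribʳ-xor (g zero) _) ⟩
  not (Σ₂ g)                    ∎
  where
  open ≡-Reasoning
  tails : DiffersOnlyAt j (f ∘ suc) (g ∘ suc)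
  tails = at-j , λ i i≢j → off-j (suc i) (i≢j ∘ Fin.suc-injective)

·-differsOnlyAt : ∀ {n} (A : Mat₂ n) r {j} {u v : Vec₂ n} → A r j ≡ true →
                  DiffersOnlyAt j u v → (A · u) r ≡ not ((A · v) r)
·-differsOnlyAt A r {j} {u} {v} Arj≡true (at-j , off-j) =
  Σ₂-differsOnlyAt (at-j' , λ i i≢j → cong (A r i ∧_) (off-j i i≢j))
  where
  at-j' : A r j ∧ u j ≡ not (A r j ∧ v j)
  at-j' rewrite Arj≡true = at-j

w-last : ∀ k m (i : Fin k) → IsLast i → w k m i ≡ bit m 0
w-last (suc zero)    m zero    _    = refl
w-last (suc (suc k)) m zero    ()
w-last (suc k)       m (suc i) last = w-last k m i (suc-injective last)

w-nonLast : ∀ k {m m'} → m / 2 ≡ m' / 2 → (i : Fin k) → ¬ IsLast i → w k m i ≡ w k m' i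
w-nonLast (suc zero)    half zero    notLast = contradiction refl notLast
w-nonLast (suc (suc k)) half zero    notLast = cong (λ x → bit x k) half
w-nonLast (suc k)       half (suc i) notLast = w-nonLast k half i (notLast ∘ cong suc)

module _ {n : ℕ} (even : n % 2 ≡ 0) where

  bit0-even : bit n 0 ≡ false
  bit0-even rewrite even = refl

  bit0-succ-even : bit (n + 1) 0 ≡ true
  bit0-succ-even rewrite %-distribˡ-+ n 1 2 {{_}} | even = refl

  half-succ-even : (n + 1) / 2 ≡ n / 2
  half-succ-even = begin
    (n + 1) / 2     ≡⟨ +-distrib-/ n 1 (subst (λ r → r + 1 < 2) (sym even) ≤-refl) ⟩
    n / 2 + 1 / 2   ≡⟨ +-identityʳ (n / 2) ⟩
    n / 2           ∎
    where open ≡-Reasoning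

  w-differsOnlyAt-last : ∀ k {j : Fin k} → IsLast j → DiffersOnlyAt j (w k n) (w k (n + 1))
  w-differsOnlyAt-last k {j} last =
    at-j , λ i i≢j → w-nonLast k (sym half-succ-even) i (i≢j ∘ λ last-i → IsLast-unique last-i last)
    where
    at-j : w k n j ≡ not (w k (n + 1) j)
    at-j rewrite w-last k n j last | w-last k (n + 1) j last | bit0-even | bit0-succ-even = refl

-- The bound n + 2 ≤ 2^e only ensures that w_{n+1} is one of the listed vectors;
-- w truncates to the last e bits, so the argument does not need it.
lemma4 : (d : ℕ) (n : ℕ) → n % 2 ≡ 0 → n + 2 ≤ 2 ^ (2 ^ d) →
    (ν : Fin (2 ^ d) → ℕ) → Suitable (2 ^ d) ν →
    ∀ (i : Fin (2 ^ d)) →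
      (Mν d ν · w (2 ^ d) n) i ≡ not ((Mν d ν · w (2 ^ d) (n + 1)) i)
lemma4 d n even _ ν (lastShift≡0 , _) i with last-of i
... | j , last =
  ·-differsOnlyAt (Mν d ν) i (Mν-lastColumn d ν i j (lastShift≡0 j last) last)
                  (w-differsOnlyAt-last even (2 ^ d) last)
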